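{- Let $\mathcal X$ be a scheme on $\Omega$ satisfying the $e_1/e_0$-condition, and assume that for all $\alpha,\alpha'\in\Omega$, $$\mathrm{Iso}_{\alpha_0,\alpha'_0}(\mathcal X_0,\mathcal X_0,\mathrm{id})^{\Delta_0}=\mathrm{Iso}_{\alpha,\alpha'}(\mathcal X_\Delta,\mathcal X_{\Delta'},\mathrm{id}_{\Delta,\Delta'})^{\Delta_0},$$ where $\Delta,\Delta'$ are the $e_1$-classes of $\alpha,\alpha'$. Then $\mathcal X$ is schurian if and only if $\mathcal X_0$ is schurian and $\mathcal X_1=\mathcal X_\Delta$ is schurian for some $\alpha\in\Omega$ (with $\Delta$ the $e_1$-class containing $\alpha$).
   Context: A coherent configuration $\mathcal X=(\Omega,S)$ ($\Omega$ finite) is a partition $S$ of $\Omega^2$ with $1_\Omega$ a union of elements of $S$, closed under transposition, with intersection numbers $c_{rs}^t=|\alpha r\cap\beta s^*|$ independent of $(\alpha,\beta)\in t$; a scheme if $1_\Omega\in S$. Relations: unions of elements of $S$; parabolics: relations that are equivalence relations. $\mathrm{Aut}(\mathcal X)$ is the group of permutations of $\Omega$ fixing every $s\in S$; $\mathcal X$ is schurian if $S$ is the set of orbits of $\mathrm{Aut}(\mathcal X)$ on $\Omega^2$. For schemes $\mathcal Y,\mathcal Y'$ and an algebraic isomorphism $\psi$ (bijection of basis relations preserving intersection numbers), $\mathrm{Iso}_{\beta,\beta'}(\mathcal Y,\mathcal Y',\psi)$ is the set of bijections $f$ with $s^f=\psi(s)$ for all basis relations $s$ and $\beta^f=\beta'$.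 For an equivalence relation $e$ and $s\subseteq\Omega^2$, $s_{\Omega/e}=\{(\Gamma,\Gamma'):s\cap(\Gamma\times\Gamma')\ne\emptyset\}$; $\mathrm{rad}(s)$ is the largest equivalence relation $e$ with $s=\bigcup_{(\Gamma,\Gamma')\in s_{\Omega/e}}\Gamma\times\Gamma'$. For parabolics $e_0\subseteq e_1$, $\mathcal X$ satisfies the $e_1/e_0$-condition if $s\cap e_1=\emptyset\Rightarrow e_0\subseteq\mathrm{rad}(s)$ for all $s\in S$. Notation: $\mathcal X_0$ is the quotient scheme on $\Omega_0=\Omega/e_0$ (basis relations $s_{\Omega/e_0}$), $\mathrm{id}$ its identity algebraic automorphism; $\alpha_0=\alpha e_0$; for an $e_1$-class $\Delta$, $\Delta_0=\Delta/e_0\subseteq\Omega_0$ and $\mathcal X_\Delta$ is the restriction (basis relations the nonempty $s\cap\Delta^2$); $\mathrm{id}_{\Delta,\Delta'}:\mathcal X_\Delta\to\mathcal X_{\Delta'}$ is $s\cap\Delta^2\mapsto s\cap\Delta'^2$. For a set $B$ of bijections, $B^{\Delta_0}$ is the set of bijections $\Delta_0\to\Delta'_0$ obtained from elements of $B$ mapping $\Delta_0$ onto $\Delta'_0$ (restriction, for maps on $\Omega_0$) or mapping $e_0$-classes in $\Delta$ onto $e_0$-classes in $\Delta'$ (induced map, for maps $\Delta\to\Delta'$). -}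

module Defs where

open import Level using (0ℓ)
open import Data.Nat using (ℕ; zero; suc; _+_; _≟_)
open import Data.Bool using (Bool; if_then_else_; _∧_)
open import Data.Fin using (Fin; zero; suc)
open import Data.Fin.Permutation using (Permutation′; _⟨$⟩ʳ_)
open import Data.Product using (Σ; ∃; _×_)
open import Function using (_∘_)
open import Relation.Nullary using (¬_)
open import Relation.Nullary.Decidable using (⌊_⌋)
open import Relation.Binary.Core using (Rel)
open import Relation.Binary.Structures using (IsEquivalence)
open import Relation.Binary.PropositionalEquality using (_≡_)

count : ∀ {n} → (Fin n → Bool) → ℕ
count {zero}  p = 0
count {suc n} p = (if p zero then 1 else 0) + count (p ∘ suc)

-- A partition S of Ω² (Ω = Fin n) is given by a colouring: the basis
-- relations are the nonempty fibres  { (x , y) | c x y ≡ i }.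
Colouring : ℕ → Set
Colouring n = Fin n → Fin n → ℕ

module _ {n : ℕ} (c : Colouring n) where

  inter : ℕ → ℕ → Fin n → Fin n → ℕ
  inter r s α β = count (λ γ → ⌊ c α γ ≟ r ⌋ ∧ ⌊ c γ β ≟ s ⌋)

  record IsCoherentConfiguration : Set where
    field
      -- 1_Ω is a union of basis relations
      diagonal-union   : ∀ x y z → c x x ≡ c y z → y ≡ z
      transpose-closed : ∀ x y x′ y′ → c x y ≡ c x′ y′ → c y x ≡ c y′ x′
      intersection     : ∀ r s x y x′ y′ → c x y ≡ c x′ y′ →
                         inter r s x y ≡ inter r s x′ y′

  record IsScheme : Set where
    field
      isCC           : IsCoherentConfiguration
      diagonal-basis : ∀ x y → c x x ≡ c y y

  record IsParabolic (e : Rel (Fin n) 0ℓ) : Set where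
    field
      isEquivalence  : IsEquivalence e
      union-of-basis : ∀ x y x′ y′ → c x y ≡ c x′ y′ → e x y → e x′ y′

  _⊆ᵣ_ : Rel (Fin n) 0ℓ → Rel (Fin n) 0ℓ → Set
  e ⊆ᵣ e′ = ∀ x y → e x y → e′ x y

  -- (x e , y e) ∈ (s_i)_{Ω/e}, where s_i is the basis relation of colour i
  QRel : Rel (Fin n) 0ℓ → ℕ → Fin n → Fin n → Set
  QRel e i x y = ∃ λ x′ → ∃ λ y′ → e x x′ × e y y′ × c x′ y′ ≡ i

  -- e ⊆ rad(s_i): e is contained in some equivalence relation e′ with
  -- s_i = ⋃_{(Γ,Γ′) ∈ (s_i)_{Ω/e′}} Γ × Γ′  (rad(s_i) is the largest such e′)
  _⊆rad_ : Rel (Fin n) 0ℓ → ℕ → Set₁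
  e ⊆rad i = Σ (Rel (Fin n) 0ℓ) λ e′ → IsEquivalence e′ × e ⊆ᵣ e′ ×
             (∀ x y → (c x y ≡ i → QRel e′ i x y) × (QRel e′ i x y → c x y ≡ i))

  -- the e₁/e₀-condition (s ranges over the basis relations s = s_{c a b})
  Condition : Rel (Fin n) 0ℓ → Rel (Fin n) 0ℓ → Set₁
  Condition e₀ e₁ = ∀ a b → (∀ x y → c x y ≡ c a b → ¬ e₁ x y) → e₀ ⊆rad c a b

  IsAut : Permutation′ n → Set
  IsAut σ = ∀ u v → c (σ ⟨$⟩ʳ u) (σ ⟨$⟩ʳ v) ≡ c u v

  Schurian : Set
  Schurian = ∀ x y x′ y′ → c x y ≡ c x′ y′ →
             ∃ λ σ → IsAut σ × σ ⟨$⟩ʳ x ≡ x′ × σ ⟨$⟩ʳ y ≡ y′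

  -- The quotient X₀ on Ω₀ = Ω/e₀.  A point of Ω₀ is represented by any point
  -- of its class; a map Ω₀ → Ω₀ by an e₀-respecting map g : Ω → Ω.
  record IsQuotBij (e₀ : Rel (Fin n) 0ℓ) (g : Fin n → Fin n) : Set where
    field
      respects   : ∀ x y → e₀ x y → e₀ (g x) (g y)
      injective  : ∀ x y → e₀ (g x) (g y) → e₀ x y
      surjective : ∀ y → ∃ λ x → e₀ (g x) y

  record IsAut₀ (e₀ : Rel (Fin n) 0ℓ) (g : Fin n → Fin n) : Set where
    field
      bij      : IsQuotBij e₀ g
      preserve : ∀ i x y → (QRel e₀ i x y → QRel e₀ i (g x) (g y)) ×
                           (QRel e₀ i (g x) (g y) → QRel e₀ i x y)

  IsIso₀ : Rel (Fin n) 0ℓ → Fin n → Fin n → (Fin n → Fin n) → Set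
  IsIso₀ e₀ α α′ g = IsAut₀ e₀ g × e₀ (g α) α′

  Schurian₀ : Rel (Fin n) 0ℓ → Set
  Schurian₀ e₀ = ∀ x y x′ y′ → (∃ λ i → QRel e₀ i x y × QRel e₀ i x′ y′) →
                 ∃ λ g → IsAut₀ e₀ g × e₀ (g x) x′ × e₀ (g y) y′

  MapsOnto₀ : Rel (Fin n) 0ℓ → Rel (Fin n) 0ℓ → Fin n → Fin n → (Fin n → Fin n) → Set
  MapsOnto₀ e₀ e₁ α α′ g =
    (∀ x → e₁ α x → e₁ α′ (g x)) ×
    (∀ y → e₁ α′ y → ∃ λ x → e₁ α x × e₀ (g x) y)

  -- Restrictions X_Δ for the e₁-class Δ = α e₁.  A map Δ → Δ′ is represented
  -- by a function f : Ω → Ω of which only the values on Δ matter.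
  record IsIsoΔ (e₁ : Rel (Fin n) 0ℓ) (α α′ : Fin n) (f : Fin n → Fin n) : Set where
    field
      into       : ∀ x → e₁ α x → e₁ α′ (f x)
      injective  : ∀ x y → e₁ α x → e₁ α y → f x ≡ f y → x ≡ y
      surjective : ∀ y → e₁ α′ y → ∃ λ x → e₁ α x × f x ≡ y
      colour     : ∀ x y → e₁ α x → e₁ α y → c (f x) (f y) ≡ c x y

  IsIsoΔpt : Rel (Fin n) 0ℓ → Fin n → Fin n → (Fin n → Fin n) → Set
  IsIsoΔpt e₁ α α′ f = IsIsoΔ e₁ α α′ f × f α ≡ α′

  MapsClasses : Rel (Fin n) 0ℓ → Rel (Fin n) 0ℓ → Fin n → (Fin n → Fin n) → Set
  MapsClasses e₀ e₁ α f =
    ∀ x → e₁ α x →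
      (∀ y → e₁ α y → e₀ x y → e₀ (f x) (f y)) ×
      (∀ z → e₀ (f x) z → ∃ λ y → e₁ α y × e₀ x y × f y ≡ z)

  SchurianΔ : Rel (Fin n) 0ℓ → Fin n → Set
  SchurianΔ e₁ α = ∀ x y x′ y′ → e₁ α x → e₁ α y → e₁ α x′ → e₁ α y′ →
                   c x y ≡ c x′ y′ →
                   ∃ λ f → IsIsoΔ e₁ α α f × f x ≡ x′ × f y ≡ y′

  -- Iso_{α₀,α′₀}(X₀,X₀,id)^{Δ₀} = Iso_{α,α′}(X_Δ,X_Δ′,id_{Δ,Δ′})^{Δ₀}
  -- as sets of maps Δ₀ → Δ′₀ (two representatives give the same map Δ₀ → Δ′₀
  -- iff they agree modulo e₀ on Δ).
  IsoHyp : Rel (Fin n) 0ℓ → Rel (Fin n) 0ℓ → Set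
  IsoHyp e₀ e₁ = ∀ α α′ →
    (∀ g → IsIso₀ e₀ α α′ g → MapsOnto₀ e₀ e₁ α α′ g →
       ∃ λ f → IsIsoΔpt e₁ α α′ f × MapsClasses e₀ e₁ α f ×
               (∀ x → e₁ α x → e₀ (g x) (f x))) ×
    (∀ f → IsIsoΔpt e₁ α α′ f → MapsClasses e₀ e₁ α f →
       ∃ λ g → IsIso₀ e₀ α α′ g × MapsOnto₀ e₀ e₁ α α′ g ×
               (∀ x → e₁ α x → e₀ (g x) (f x)))

-- An automorphism of X induces an automorphism of X₀ and isomorphisms between
-- e₁-classes, which gives one direction. Conversely, to move (x, y) to a pair
-- (x′, y′) of the same colour, take g ∈ Aut(X₀) moving them together modulo e₀
-- and, on every e₁-class, an isomorphism inducing g (supplied by the Iso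
-- hypothesis), and glue these. Inside a class colours are preserved by
-- construction; between classes the e₁/e₀-condition makes the basis relation a
-- union of products of e₀-classes, so it only depends on g. When x and y share
-- an e₁-class, schurity of one restriction, transported along class
-- isomorphisms, gives the isomorphism on the class of x and the Iso hypothesis
-- then gives g.

module Submission where

open import Level using (0ℓ)
open import Data.Nat using (ℕ; zero; suc)
import Data.Nat as ℕ
open import Data.Nat.Properties using (n≮n)
open import Data.Bool using (Bool; true; false; T)
open import Data.Maybe using (Maybe; just; nothing; maybe′)
import Data.Maybe as Maybe
open import Data.Fin using (Fin; zero; suc; punchOut; _≟_)
open import Data.Fin.Properties using (any?; all?; ∀-cons; punchOut-injective; injective⇒≤)
open import Data.Fin.Permutation
  using (Permutation′; _⟨$⟩ʳ_; _⟨$⟩ˡ_; permutation; flip; inverseˡ; inverseʳ)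
open import Data.Vec.Functional using (_∷_)
open import Data.Vec.Functional.Properties using (∷-cong)
open import Data.Product using (Σ; ∃; _×_; _,_; proj₁; proj₂)
open import Data.Unit using (tt)
open import Data.Empty using (⊥-elim)
open import Function using (_∘_; id)
open import Function.Bundles using (_⇔_; mk⇔)
open import Function.Definitions using (Injective)
open import Relation.Nullary using (¬_; Dec; yes; no; contradiction)
open import Relation.Nullary.Decidable
  using (⌊_⌋; toWitness; fromWitness; map′; _×-dec_; decidable-stable; isYes≗does; does-⇔;
         ¬¬-excluded-middle)
open import Relation.Nullary.Negation using (¬¬-map)
open import Relation.Unary using (Pred)
open import Relation.Binary.Core using (Rel)
open import Relation.Binary.Definitions using (Decidable)
open import Relation.Binary.Structures using (IsEquivalence)
open import Relation.Binary.PropositionalEquality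
  using (_≡_; _≢_; refl; sym; trans; cong; cong₂; subst; subst₂; _≗_; module ≡-Reasoning)
open import Defs

firstTrue : ∀ {m} → (Fin m → Bool) → Maybe (Fin m)
firstTrue {zero}  p = nothing
firstTrue {suc m} p with p zero
... | true  = just zero
... | false = Maybe.map suc (firstTrue (p ∘ suc))

firstTrue-cong : ∀ {m} {p q : Fin m → Bool} → p ≗ q → firstTrue p ≡ firstTrue q
firstTrue-cong {zero}  p≗q = refl
firstTrue-cong {suc m} {p} {q} p≗q with p zero | q zero | p≗q zero
... | true  | true  | _ = refl
... | false | false | _ = cong (Maybe.map suc) (firstTrue-cong (p≗q ∘ suc))

firstTrue-complete : ∀ {m} (p : Fin m → Bool) {a} → T (p a) →
                     ∃ λ b → firstTrue p ≡ just b × T (p b)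
firstTrue-complete {suc m} p pa with p zero in eq
... | true = zero , refl , subst T (sym eq) tt
firstTrue-complete {suc m} p {zero}  pa | false = ⊥-elim (subst T eq pa)
firstTrue-complete {suc m} p {suc a} pa | false with firstTrue-complete (p ∘ suc) pa
... | b , found , pb = suc b , cong (Maybe.map suc) found , pb

module Representatives {m} {_∼_ : Rel (Fin m) 0ℓ}
  (∼-equivalence : IsEquivalence _∼_) (_∼?_ : Decidable _∼_) where

  open IsEquivalence ∼-equivalence
    renaming (refl to ∼-refl; sym to ∼-sym; trans to ∼-trans)

  classOf : Fin m → Fin m → Bool
  classOf w z = ⌊ w ∼? z ⌋

  -- The default value w is never used: the class of w is inhabited.
  rep : Fin m → Fin m
  rep w = maybe′ id w (firstTrue (classOf w))

  rep-related : ∀ w → w ∼ rep w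
  rep-related w with firstTrue-complete (classOf w) (fromWitness ∼-refl)
  ... | b , found , w∼b rewrite found = toWitness w∼b

  rep-cong : ∀ {u v} → u ∼ v → rep u ≡ rep v
  rep-cong {u} {v} u∼v with firstTrue-complete (classOf u) (fromWitness ∼-refl)
  ... | b , found , _ = begin
    maybe′ id u (firstTrue (classOf u)) ≡⟨ cong (maybe′ id u) found ⟩
    b                                   ≡⟨ cong (maybe′ id v) found′ ⟨
    maybe′ id v (firstTrue (classOf v)) ∎
    where
    open ≡-Reasoning
    sameClass : classOf u ≗ classOf v
    sameClass z = begin
      ⌊ u ∼? z ⌋    ≡⟨ isYes≗does (u ∼? z) ⟩
      _             ≡⟨ does-⇔ (mk⇔ (∼-trans (∼-sym u∼v)) (∼-trans u∼v)) (u ∼? z) (v ∼? z) ⟩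
      _             ≡⟨ isYes≗does (v ∼? z) ⟨
      ⌊ v ∼? z ⌋    ∎
    found′ : firstTrue (classOf v) ≡ just b
    found′ = trans (sym (firstTrue-cong sameClass)) found

¬¬-Π : ∀ {m} {A : Fin m → Set} → (∀ i → ¬ ¬ A i) → ¬ ¬ (∀ i → A i)
¬¬-Π {zero}  _ k = k (λ ())
¬¬-Π {suc m} h k = h zero λ a₀ → ¬¬-Π (h ∘ suc) λ as → k (∀-cons a₀ as)

¬¬-decidable : ∀ {m} (R : Rel (Fin m) 0ℓ) → ¬ ¬ Decidable R
¬¬-decidable R = ¬¬-Π λ u → ¬¬-Π λ v → ¬¬-excluded-middle

anyFunction? : ∀ {m k} {P : Pred (Fin m → Fin k) 0ℓ} →
               (∀ {f g} → f ≗ g → P f → P g) → (∀ f → Dec (P f)) → Dec (∃ P)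
anyFunction? {zero} {k} resp P? =
  map′ (λ p → empty , p) (λ (f , p) → resp (λ ()) p) (P? empty)
  where
  empty : Fin 0 → Fin k
  empty ()
anyFunction? {suc m} {P = P} resp P? =
  map′ (λ (a , f , p) → a ∷ f , p)
       (λ (f , p) → f zero , f ∘ suc , resp (∷-cong refl (λ _ → refl)) p)
       (any? λ a → anyFunction? {P = P ∘ (a ∷_)} (resp ∘ ∷-cong refl) (P? ∘ (a ∷_)))

injective⇒surjective : ∀ {m} {f : Fin m → Fin m} → Injective _≡_ _≡_ f →
                       ∀ y → ∃ λ x → f x ≡ y
injective⇒surjective {suc k} {f} f-injective y with any? (λ x → f x ≟ y)
... | yes hit = hit
... | no miss = contradiction (injective⇒≤ f′-injective) (n≮n k)
  where
  missed : ∀ x → y ≢ f x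
  missed x = miss ∘ (x ,_) ∘ sym
  f′ : Fin (suc k) → Fin k
  f′ x = punchOut (missed x)
  f′-injective : Injective _≡_ _≡_ f′
  f′-injective {a} {b} eq = f-injective (punchOut-injective (missed a) (missed b) eq)

injective⇒permutation : ∀ {m} {f : Fin m → Fin m} → Injective _≡_ _≡_ f →
                        Σ (Permutation′ m) λ σ → ∀ x → σ ⟨$⟩ʳ x ≡ f x
injective⇒permutation {f = f} f-injective =
  permutation f (proj₁ ∘ surj) (proj₂ ∘ surj) (λ x → f-injective (proj₂ (surj (f x)))) ,
  λ _ → refl
  where
  surj : ∀ y → ∃ λ x → f x ≡ y
  surj = injective⇒surjective f-injective

module _ {n : ℕ} {c : Colouring n} where

  PreservesColours : (Fin n → Fin n) → Set
  PreservesColours f = ∀ u v → c (f u) (f v) ≡ c u v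

  Transporter : Fin n → Fin n → Fin n → Fin n → (Fin n → Fin n) → Set
  Transporter x y x′ y′ f = PreservesColours f × f x ≡ x′ × f y ≡ y′

  transporter? : ∀ x y x′ y′ f → Dec (Transporter x y x′ y′ f)
  transporter? x y x′ y′ f =
    all? (λ u → all? λ v → c (f u) (f v) ℕ.≟ c u v) ×-dec (f x ≟ x′ ×-dec f y ≟ y′)

  transporter-resp : ∀ {x y x′ y′ f g} → f ≗ g →
                     Transporter x y x′ y′ f → Transporter x y x′ y′ g
  transporter-resp f≗g (f-colours , fx , fy) =
    (λ u v → trans (cong₂ c (sym (f≗g u)) (sym (f≗g v))) (f-colours u v)) ,
    trans (sym (f≗g _)) fx ,
    trans (sym (f≗g _)) fy

  preservesColours⇒injective : IsCoherentConfiguration c → ∀ {f} →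
                               PreservesColours f → Injective _≡_ _≡_ f
  preservesColours⇒injective cc {f} f-colours {u} {v} fu≡fv =
    IsCoherentConfiguration.diagonal-union cc u u v (begin
      c u u         ≡⟨ f-colours u u ⟨
      c (f u) (f u) ≡⟨ cong (c (f u)) fu≡fv ⟩
      c (f u) (f v) ≡⟨ f-colours u v ⟩
      c u v         ∎)
    where open ≡-Reasoning

  transporter⇒aut : IsCoherentConfiguration c → ∀ {x y x′ y′ f} → Transporter x y x′ y′ f →
                    ∃ λ σ → IsAut c σ × σ ⟨$⟩ʳ x ≡ x′ × σ ⟨$⟩ʳ y ≡ y′
  transporter⇒aut cc t@(f-colours , _)
    with injective⇒permutation (preservesColours⇒injective cc f-colours)
  ... | σ , σ≗f = σ , transporter-resp (sym ∘ σ≗f) t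

  rad-saturated : ∀ {e i x y} → _⊆rad_ c e i → QRel c e i x y → c x y ≡ i
  rad-saturated (_ , _ , e⊆e′ , s≡⋃) (x₁ , y₁ , xx₁ , yy₁ , col) =
    proj₂ (s≡⋃ _ _) (x₁ , y₁ , e⊆e′ _ _ xx₁ , e⊆e′ _ _ yy₁ , col)

  isoΔ-∘ : ∀ {e α β γ f g} → IsIsoΔ c e α β f → IsIsoΔ c e β γ g → IsIsoΔ c e α γ (g ∘ f)
  isoΔ-∘ {f = f} {g} f-iso g-iso = record
    { into       = λ x αx → G.into _ (F.into x αx)
    ; injective  = λ x y αx αy gfx≡gfy →
        F.injective x y αx αy (G.injective _ _ (F.into x αx) (F.into y αy) gfx≡gfy)
    ; surjective = λ z γz →
        let (y , βy , gy≡z) = G.surjective z γz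
            (x , αx , fx≡y) = F.surjective y βy
        in x , αx , trans (cong g fx≡y) gy≡z
    ; colour     = λ x y αx αy →
        trans (G.colour _ _ (F.into x αx) (F.into y αy)) (F.colour x y αx αy)
    }
    where
    module F = IsIsoΔ f-iso
    module G = IsIsoΔ g-iso

  aut-inverse : ∀ σ → IsAut c σ → IsAut c (flip σ)
  aut-inverse σ σ-aut u v = begin
    c (σ ⟨$⟩ˡ u) (σ ⟨$⟩ˡ v)                     ≡⟨ σ-aut _ _ ⟨
    c (σ ⟨$⟩ʳ (σ ⟨$⟩ˡ u)) (σ ⟨$⟩ʳ (σ ⟨$⟩ˡ v)) ≡⟨ cong₂ c (inverseʳ σ) (inverseʳ σ) ⟩
    c u v                                       ∎
    where open ≡-Reasoning

  module _ {e : Rel (Fin n) 0ℓ} (e-parabolic : IsParabolic c e)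
           (σ : Permutation′ n) (σ-aut : IsAut c σ) where

    open IsParabolic e-parabolic using (union-of-basis)
    private module E = IsEquivalence (IsParabolic.isEquivalence e-parabolic)

    aut-preserves : ∀ {x y} → e x y → e (σ ⟨$⟩ʳ x) (σ ⟨$⟩ʳ y)
    aut-preserves {x} {y} = union-of-basis x y _ _ (sym (σ-aut x y))

    aut-reflects : ∀ {x y} → e (σ ⟨$⟩ʳ x) (σ ⟨$⟩ʳ y) → e x y
    aut-reflects {x} {y} = union-of-basis _ _ x y (σ-aut x y)

    aut-preservesQRel : ∀ {i x y} → QRel c e i x y → QRel c e i (σ ⟨$⟩ʳ x) (σ ⟨$⟩ʳ y)
    aut-preservesQRel (x₁ , y₁ , xx₁ , yy₁ , col) =
      σ ⟨$⟩ʳ x₁ , σ ⟨$⟩ʳ y₁ , aut-preserves xx₁ , aut-preserves yy₁ , trans (σ-aut x₁ y₁) col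

    aut⇒isoΔ : ∀ {α α′} → e α′ (σ ⟨$⟩ʳ α) → IsIsoΔ c e α α′ (σ ⟨$⟩ʳ_)
    aut⇒isoΔ {α} {α′} α′∼σα = record
      { into       = λ _ αx → E.trans α′∼σα (aut-preserves αx)
      ; injective  = λ x y _ _ σx≡σy → begin
          x                       ≡⟨ inverseˡ σ ⟨
          σ ⟨$⟩ˡ (σ ⟨$⟩ʳ x)     ≡⟨ cong (σ ⟨$⟩ˡ_) σx≡σy ⟩
          σ ⟨$⟩ˡ (σ ⟨$⟩ʳ y)     ≡⟨ inverseˡ σ ⟩
          y                       ∎
      ; surjective = λ z α′z → σ ⟨$⟩ˡ z ,
          aut-reflects (subst (e (σ ⟨$⟩ʳ α)) (sym (inverseʳ σ)) (E.trans (E.sym α′∼σα) α′z)) ,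
          inverseʳ σ
      ; colour     = λ x y _ _ → σ-aut x y
      }
      where open ≡-Reasoning

  aut-reflectsQRel : ∀ {e} → IsParabolic c e → ∀ σ → IsAut c σ →
                     ∀ {i x y} → QRel c e i (σ ⟨$⟩ʳ x) (σ ⟨$⟩ʳ y) → QRel c e i x y
  aut-reflectsQRel {e} e-parabolic σ σ-aut {i} =
    subst₂ (QRel c e i) (inverseˡ σ) (inverseˡ σ) ∘
    aut-preservesQRel e-parabolic (flip σ) (aut-inverse σ σ-aut)

  aut⇒aut₀ : ∀ {e₀} → IsParabolic c e₀ → ∀ σ → IsAut c σ → IsAut₀ c e₀ (σ ⟨$⟩ʳ_)
  aut⇒aut₀ e₀-parabolic σ σ-aut = record
    { bij      = record
      { respects   = λ _ _ → aut-preserves e₀-parabolic σ σ-aut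
      ; injective  = λ _ _ → aut-reflects e₀-parabolic σ σ-aut
      ; surjective = λ y → σ ⟨$⟩ˡ y , E₀.reflexive (inverseʳ σ)
      }
    ; preserve = λ _ _ _ → aut-preservesQRel e₀-parabolic σ σ-aut ,
                           aut-reflectsQRel e₀-parabolic σ σ-aut
    }
    where module E₀ = IsEquivalence (IsParabolic.isEquivalence e₀-parabolic)

  schurian⇒schurian₀ : ∀ {e₀} → IsParabolic c e₀ → Schurian c → Schurian₀ c e₀
  schurian⇒schurian₀ {e₀} e₀-parabolic S x y x′ y′
    (_ , (x₁ , y₁ , xx₁ , yy₁ , col) , (x₁′ , y₁′ , x′x₁′ , y′y₁′ , col′))
    with S x₁ y₁ x₁′ y₁′ (trans col (sym col′))
  ... | σ , σ-aut , σx₁ , σy₁ =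
    σ ⟨$⟩ʳ_ , aut⇒aut₀ e₀-parabolic σ σ-aut , moved xx₁ σx₁ x′x₁′ , moved yy₁ σy₁ y′y₁′
    where
    module E₀ = IsEquivalence (IsParabolic.isEquivalence e₀-parabolic)
    moved : ∀ {z z₁ z′ z₁′} → e₀ z z₁ → σ ⟨$⟩ʳ z₁ ≡ z₁′ → e₀ z′ z₁′ → e₀ (σ ⟨$⟩ʳ z) z′
    moved zz₁ σz₁ z′z₁′ =
      E₀.trans (aut-preserves e₀-parabolic σ σ-aut zz₁)
               (subst (λ w → e₀ w _) (sym σz₁) (E₀.sym z′z₁′))

  schurian⇒schurianΔ : ∀ {e₁} → IsParabolic c e₁ → Schurian c → ∀ α → SchurianΔ c e₁ α
  schurian⇒schurianΔ {e₁} e₁-parabolic S α x y x′ y′ αx _ αx′ _ col with S x y x′ y′ col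
  ... | σ , σ-aut , σx , σy = σ ⟨$⟩ʳ_ , aut⇒isoΔ e₁-parabolic σ σ-aut α∼σα , σx , σy
    where
    module E₁ = IsEquivalence (IsParabolic.isEquivalence e₁-parabolic)
    α∼σα : e₁ α (σ ⟨$⟩ʳ α)
    α∼σα = E₁.trans (subst (e₁ α) (sym σx) αx′) (aut-preserves e₁-parabolic σ σ-aut (E₁.sym αx))

module _ {n : ℕ} {c : Colouring n} {e₀ e₁ : Rel (Fin n) 0ℓ}
         (e₀-parabolic : IsParabolic c e₀) (e₁-parabolic : IsParabolic c e₁)
         (e₀⊆e₁ : _⊆ᵣ_ c e₀ e₁) where

  private
    module E₀ = IsEquivalence (IsParabolic.isEquivalence e₀-parabolic)
    module E₁ = IsEquivalence (IsParabolic.isEquivalence e₁-parabolic)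
  open IsParabolic e₀-parabolic using () renaming (union-of-basis to e₀-union)
  open IsParabolic e₁-parabolic using () renaming (union-of-basis to e₁-union)

  QRel-refl : ∀ x y → QRel c e₀ (c x y) x y
  QRel-refl x y = x , y , E₀.refl , E₀.refl , refl

  QRel⇒e₁ : ∀ {a b x y} → e₁ a b → QRel c e₀ (c a b) x y → e₁ x y
  QRel⇒e₁ ab (x₁ , y₁ , xx₁ , yy₁ , col) =
    E₁.trans (e₀⊆e₁ _ _ xx₁) (E₁.trans (e₁-union _ _ x₁ y₁ (sym col) ab) (E₁.sym (e₀⊆e₁ _ _ yy₁)))

  module _ {g : Fin n → Fin n} (g-aut : IsAut₀ c e₀ g) where

    open IsAut₀ g-aut using (preserve)

    aut₀-preserves-e₁ : ∀ {a b} → e₁ a b → e₁ (g a) (g b)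
    aut₀-preserves-e₁ {a} {b} ab = QRel⇒e₁ ab (proj₁ (preserve _ a b) (QRel-refl a b))

    aut₀-reflects-e₁ : ∀ {a b} → e₁ (g a) (g b) → e₁ a b
    aut₀-reflects-e₁ {a} {b} gagb = QRel⇒e₁ gagb (proj₂ (preserve _ a b) (QRel-refl (g a) (g b)))

    aut₀⇒mapsOnto₀ : ∀ {α α′} → e₀ (g α) α′ → MapsOnto₀ c e₀ e₁ α α′ g
    aut₀⇒mapsOnto₀ {α} {α′} gα∼α′ =
      (λ x αx → E₁.trans (E₁.sym gα≈α′) (aut₀-preserves-e₁ αx)) ,
      (λ y α′y →
        let (x , gx∼y) = IsQuotBij.surjective (IsAut₀.bij g-aut) y
        in x , aut₀-reflects-e₁ (E₁.trans gα≈α′ (E₁.trans α′y (E₁.sym (e₀⊆e₁ _ _ gx∼y)))) , gx∼y)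
      where
      gα≈α′ : e₁ (g α) α′
      gα≈α′ = e₀⊆e₁ _ _ gα∼α′

  isoΔ⇒mapsClasses : ∀ {α α′ f} → IsIsoΔ c e₁ α α′ f → MapsClasses c e₀ e₁ α f
  isoΔ⇒mapsClasses {f = f} f-iso x αx =
    (λ y αy x∼y → e₀-union x y _ _ (sym (colour x y αx αy)) x∼y) ,
    (λ z fx∼z →
      let (y , αy , fy≡z) = surjective z (E₁.trans (into x αx) (e₀⊆e₁ _ _ fx∼z))
      in y , αy , e₀-union _ _ x y (colour x y αx αy) (subst (e₀ (f x)) (sym fy≡z) fx∼z) , fy≡z)
    where open IsIsoΔ f-iso

  LocalLift : (Fin n → Fin n) → Fin n → (Fin n → Fin n) → Set
  LocalLift g α f = (∀ u v → e₁ α u → e₁ α v → c (f u) (f v) ≡ c u v) ×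
                    (∀ w → e₁ α w → e₀ (g w) (f w))

  Lifts : (Fin n → Fin n) → (Fin n → Fin n → Fin n) → Set
  Lifts g Φ = ∀ r → LocalLift g r (Φ r)

  isoΔ⇒localLift : ∀ {g α α′ f} → IsIsoΔ c e₁ α α′ f → (∀ w → e₁ α w → e₀ (g w) (f w)) →
                   LocalLift g α f
  isoΔ⇒localLift f-iso induced = IsIsoΔ.colour f-iso , induced

  localLift-cong : ∀ {g p r f} → e₁ r p → LocalLift g p f → LocalLift g r f
  localLift-cong rp (colours , induced) =
    (λ u v ru rv → colours u v (E₁.trans (E₁.sym rp) ru) (E₁.trans (E₁.sym rp) rv)) ,
    (λ w rw → induced w (E₁.trans (E₁.sym rp) rw))

  isoΔ-transfer : ∀ {α x x′ y y′ T T′} → SchurianΔ c e₁ α →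
                  IsIsoΔpt c e₁ x α T → IsIsoΔpt c e₁ α x′ T′ →
                  e₁ x y → c x y ≡ c x′ y′ →
                  ∃ λ K → IsIsoΔ c e₁ x x′ K × K x ≡ x′ × K y ≡ y′
  isoΔ-transfer {α} {x} {x′} {y} {y′} {T} {T′} S₁ (T-iso , Tx) (T′-iso , T′α) xy col
    with IsIsoΔ.surjective T′-iso y′ (e₁-union x y x′ y′ col xy)
  ... | q , αq , T′q with S₁ α (T y) α q E₁.refl (IsIsoΔ.into T-iso y xy) E₁.refl αq colours
    where
    open ≡-Reasoning
    colours : c α (T y) ≡ c α q
    colours = begin
      c α (T y)        ≡⟨ cong (λ z → c z (T y)) Tx ⟨
      c (T x) (T y)    ≡⟨ IsIsoΔ.colour T-iso x y E₁.refl xy ⟩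
      c x y            ≡⟨ col ⟩
      c x′ y′          ≡⟨ cong₂ c T′α T′q ⟨
      c (T′ α) (T′ q)  ≡⟨ IsIsoΔ.colour T′-iso α q E₁.refl αq ⟩
      c α q            ∎
  ... | h , h-iso , hα , hTy =
    T′ ∘ h ∘ T , isoΔ-∘ (isoΔ-∘ T-iso h-iso) T′-iso ,
    trans (cong T′ (trans (cong h Tx) hα)) T′α ,
    trans (cong T′ hTy) T′q

  module _ (iso-hyp : IsoHyp c e₀ e₁) where

    aut₀⇒isoΔ : ∀ {g} → IsAut₀ c e₀ g → ∀ {α α′} → e₀ (g α) α′ →
                ∃ λ f → IsIsoΔpt c e₁ α α′ f × (∀ w → e₁ α w → e₀ (g w) (f w))
    aut₀⇒isoΔ {g} g-aut {α} {α′} gα∼α′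
      with proj₁ (iso-hyp α α′) g (g-aut , gα∼α′) (aut₀⇒mapsOnto₀ g-aut gα∼α′)
    ... | f , f-iso , _ , induced = f , f-iso , induced

    aut₀⇒lifts : ∀ {g} → IsAut₀ c e₀ g → Σ (Fin n → Fin n → Fin n) (Lifts g)
    aut₀⇒lifts {g} g-aut = proj₁ ∘ lift , λ r → let (_ , (f-iso , _) , induced) = lift r
                                           in isoΔ⇒localLift f-iso induced
      where
      lift : ∀ r → ∃ λ f → IsIsoΔpt c e₁ r (g r) f × (∀ w → e₁ r w → e₀ (g w) (f w))
      lift r = aut₀⇒isoΔ g-aut E₀.refl

    module _ (scheme : IsScheme c) (S₀ : Schurian₀ c e₀) where

      aut₀-transitive : ∀ a b → ∃ λ g → IsAut₀ c e₀ g × e₀ (g a) b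
      aut₀-transitive a b
        with S₀ a a b b (c a a , QRel-refl a a ,
                         b , b , E₀.refl , E₀.refl , IsScheme.diagonal-basis scheme b a)
      ... | g , g-aut , ga∼b , _ = g , g-aut , ga∼b

      classes-isomorphic : ∀ a b → ∃ λ f → IsIsoΔpt c e₁ a b f
      classes-isomorphic a b =
        let (g , g-aut , ga∼b) = aut₀-transitive a b
            (f , f-iso , _)    = aut₀⇒isoΔ g-aut ga∼b
        in f , f-iso

      module Gluing (condition : Condition c e₀ e₁) (_e₁?_ : Decidable e₁) where

        open Representatives (IsParabolic.isEquivalence e₁-parabolic) _e₁?_

        glue : (Fin n → Fin n → Fin n) → Fin n → Fin n
        glue Φ w = Φ (rep w) w

        glue-induces : ∀ {g Φ} → Lifts g Φ → ∀ w → e₀ (g w) (glue Φ w)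
        glue-induces Φ-lifts w = proj₂ (Φ-lifts (rep w)) w (E₁.sym (rep-related w))

        glue-preservesColours : ∀ {g Φ} → IsAut₀ c e₀ g → Lifts g Φ → PreservesColours (glue Φ)
        glue-preservesColours g-aut Φ-lifts u v with u e₁? v
        ... | yes u∼v rewrite rep-cong u∼v =
          proj₁ (Φ-lifts (rep v)) u v (E₁.trans (E₁.sym (rep-related v)) (E₁.sym u∼v))
                                      (E₁.sym (rep-related v))
        ... | no u≁v with proj₁ (IsAut₀.preserve g-aut (c u v) u v) (QRel-refl u v)
        ... | a , b , gu∼a , gv∼b , ab =
          rad-saturated (condition u v (λ x y col xy → u≁v (e₁-union x y u v col xy)))
            (a , b , E₀.trans (E₀.sym (glue-induces Φ-lifts u)) gu∼a ,
                     E₀.trans (E₀.sym (glue-induces Φ-lifts v)) gv∼b , ab)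

        _[_≔_] : (Fin n → Fin n → Fin n) → Fin n → (Fin n → Fin n) → Fin n → Fin n → Fin n
        (Φ [ p ≔ f ]) r with r e₁? p
        ... | yes _ = f
        ... | no  _ = Φ r

        [≔]-lifts : ∀ {g Φ p f} → Lifts g Φ → LocalLift g p f → Lifts g (Φ [ p ≔ f ])
        [≔]-lifts {p = p} Φ-lifts f-lifts r with r e₁? p
        ... | yes rp = localLift-cong rp f-lifts
        ... | no  _  = Φ-lifts r

        glue-[≔]-inside : ∀ {Φ p f w} → e₁ p w → glue (Φ [ p ≔ f ]) w ≡ f w
        glue-[≔]-inside {p = p} {w = w} pw with rep w e₁? p
        ... | yes _   = refl
        ... | no  w≁p = contradiction (E₁.trans (E₁.sym (rep-related w)) (E₁.sym pw)) w≁p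

        glue-[≔]-outside : ∀ {Φ p f w} → ¬ e₁ p w → glue (Φ [ p ≔ f ]) w ≡ glue Φ w
        glue-[≔]-outside {p = p} {w = w} p≁w with rep w e₁? p
        ... | yes wp = contradiction (E₁.trans (E₁.sym wp) (E₁.sym (rep-related w))) p≁w
        ... | no  _  = refl

        lifts⇒transporter : ∀ {g Φ x y x′ y′} → IsAut₀ c e₀ g → Lifts g Φ →
                            glue Φ x ≡ x′ → glue Φ y ≡ y′ → ∃ (Transporter x y x′ y′)
        lifts⇒transporter {Φ = Φ} g-aut Φ-lifts gx gy =
          glue Φ , glue-preservesColours g-aut Φ-lifts , gx , gy

        transporter-apart : ∀ {x y x′ y′} → ¬ e₁ x y → c x y ≡ c x′ y′ →
                            ∃ (Transporter x y x′ y′)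
        transporter-apart {x} {y} {x′} {y′} x≁y col
          with S₀ x y x′ y′ (c x y , QRel-refl x y , x′ , y′ , E₀.refl , E₀.refl , sym col)
        ... | g , g-aut , gx∼x′ , gy∼y′
          with aut₀⇒isoΔ g-aut gx∼x′ | aut₀⇒isoΔ g-aut gy∼y′
        ... | fx , (fx-iso , fxx) , fx-induces | fy , (fy-iso , fyy) , fy-induces =
          lifts⇒transporter g-aut Ψ-lifts (trans (glue-[≔]-inside E₁.refl) fxx) glueΨy
          where
          open ≡-Reasoning
          Φ Ψ : Fin n → Fin n → Fin n
          Φ = proj₁ (aut₀⇒lifts g-aut)
          Ψ = (Φ [ y ≔ fy ]) [ x ≔ fx ]
          Ψ-lifts : Lifts g Ψ
          Ψ-lifts = [≔]-lifts
            ([≔]-lifts (proj₂ (aut₀⇒lifts g-aut)) (isoΔ⇒localLift fy-iso fy-induces))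
            (isoΔ⇒localLift fx-iso fx-induces)
          glueΨy : glue Ψ y ≡ y′
          glueΨy = begin
            glue Ψ y              ≡⟨ glue-[≔]-outside x≁y ⟩
            glue (Φ [ y ≔ fy ]) y ≡⟨ glue-[≔]-inside E₁.refl ⟩
            fy y                  ≡⟨ fyy ⟩
            y′                    ∎

        isoΔ⇒transporter : ∀ {x y x′ y′ K} → IsIsoΔ c e₁ x x′ K → K x ≡ x′ → K y ≡ y′ → e₁ x y →
                           ∃ (Transporter x y x′ y′)
        isoΔ⇒transporter {x} {x′ = x′} {K = K} K-iso Kx Ky xy
          with proj₂ (iso-hyp x x′) K (K-iso , Kx) (isoΔ⇒mapsClasses K-iso)
        ... | g , (g-aut , _) , _ , K-induces =
          lifts⇒transporter g-aut Ψ-lifts (trans (glue-[≔]-inside E₁.refl) Kx)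
                                          (trans (glue-[≔]-inside xy) Ky)
          where
          Ψ : Fin n → Fin n → Fin n
          Ψ = proj₁ (aut₀⇒lifts g-aut) [ x ≔ K ]
          Ψ-lifts : Lifts g Ψ
          Ψ-lifts = [≔]-lifts (proj₂ (aut₀⇒lifts g-aut)) (isoΔ⇒localLift K-iso K-induces)

        transporter-within : ∀ {α x y x′ y′} → SchurianΔ c e₁ α → e₁ x y → c x y ≡ c x′ y′ →
                             ∃ (Transporter x y x′ y′)
        transporter-within {α} {x} {x′ = x′} S₁ xy col =
          let (K , K-iso , Kx , Ky) = isoΔ-transfer S₁ (proj₂ (classes-isomorphic x α))
                                                       (proj₂ (classes-isomorphic α x′)) xy col
          in isoΔ⇒transporter K-iso Kx Ky xy

        transporter : ∀ {α x y x′ y′} → SchurianΔ c e₁ α → c x y ≡ c x′ y′ →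
                      ∃ (Transporter x y x′ y′)
        transporter {x = x} {y} S₁ col with x e₁? y
        ... | yes xy = transporter-within S₁ xy col
        ... | no  x≁y = transporter-apart x≁y col

      -- e₁ need not be decidable, but the existence of a transporter is, so it
      -- may be proved under the double negation of decidability of e₁.
      schurian₀∧schurianΔ⇒schurian : Condition c e₀ e₁ → ∀ {α} → SchurianΔ c e₁ α → Schurian c
      schurian₀∧schurianΔ⇒schurian condition S₁ x y x′ y′ col =
        transporter⇒aut (IsScheme.isCC scheme) (proj₂ f)
        where
        f : ∃ (Transporter x y x′ y′)
        f = decidable-stable (anyFunction? transporter-resp (transporter? x y x′ y′))
              (¬¬-map (λ e₁? → Gluing.transporter condition e₁? S₁ col) (¬¬-decidable e₁))

corollary5p5 : ∀ (n : ℕ) (c : Colouring (suc n)) (e₀ e₁ : Rel (Fin (suc n)) 0ℓ) →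
    IsScheme c → IsParabolic c e₀ → IsParabolic c e₁ → _⊆ᵣ_ c e₀ e₁ →
    Condition c e₀ e₁ → IsoHyp c e₀ e₁ →
    (Schurian c ⇔ (Schurian₀ c e₀ × ∃ λ α → SchurianΔ c e₁ α))
corollary5p5 n c e₀ e₁ scheme e₀-parabolic e₁-parabolic e₀⊆e₁ condition iso-hyp = mk⇔
  (λ S → schurian⇒schurian₀ e₀-parabolic S , zero , schurian⇒schurianΔ e₁-parabolic S zero)
  (λ (S₀ , _ , S₁) → schurian₀∧schurianΔ⇒schurian e₀-parabolic e₁-parabolic e₀⊆e₁ iso-hyp
                        scheme S₀ condition S₁)
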